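{- Let $n=m^2$ where $m$ is an odd squarefree number. Then $C_{S(n)^*}\geq 9$.
   Context: $\mathbb Z_n=\mathbb Z/n\mathbb Z$; $S(n)^*=\{x^2:x\in\mathbb Z_n\}\setminus\{0\}$. For $A\subseteq\mathbb Z_n$, a subsequence $T$ of a sequence $(x_1,\dots,x_k)$ in $\mathbb Z_n$, with nonempty index set $I$, is an $A$-weighted zero-sum subsequence if there exist $a_i\in A$ ($i\in I$) with $\sum_{i\in I}a_ix_i=0$. $C_{S(n)^*}$ is the least positive integer $k$ such that every sequence of length $k$ in $\mathbb Z_n$ has an $S(n)^*$-weighted zero-sum subsequence consisting of consecutive terms. -}

module Defs where

open import Data.Nat using (ℕ; _*_; _+_)
open import Data.Nat.Divisibility using (_∣_)
open import Data.List using (List; []; _++_; length; zipWith; map)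
open import Data.Nat.ListAction using (sum)
open import Data.List.Relation.Unary.All using (All)
open import Data.Product using (∃; Σ; _×_)
open import Relation.Nullary using (¬_)
open import Relation.Binary.PropositionalEquality using (_≡_; _≢_)

Squarefree : ℕ → Set
Squarefree m = ∀ d → d * d ∣ m → d ≡ 1

Odd : ℕ → Set
Odd m = ¬ (2 ∣ m)

-- Elements of ℤ_n are represented by natural numbers (all residues occur).
-- A weight in S(n)^* is the class of y² with y² ≢ 0 (mod n); we record the
-- root y.
NonzeroSquareRoot : ℕ → ℕ → Set
NonzeroSquareRoot n y = ¬ (n ∣ y * y)

HasConsecutiveWZS : ℕ → List ℕ → Set
HasConsecutiveWZS n xs =
  ∃ λ pre → ∃ λ mid → ∃ λ suf →
    xs ≡ pre ++ mid ++ suf × mid ≢ [] ×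
    (∃ λ (ys : List ℕ) → length ys ≡ length mid × All (NonzeroSquareRoot n) ys ×
       n ∣ sum (zipWith _*_ (map (λ y → y * y) ys) mid))

-- k has the property defining C_{S(n)^*}: every length-k sequence in ℤ_n
-- has such a subsequence.  C_{S(n)^*} is the least positive such k.
CProperty : ℕ → ℕ → Set
CProperty n k = ∀ (xs : List ℕ) → length xs ≡ k → HasConsecutiveWZS n xs

-- Choose c such that y² + c z² ≡ 0 (mod m) forces m ∣ y and m ∣ z.  For a
-- prime p ∣ m, any c for which -c is not a square modulo p works (such c
-- exists because squares modulo an odd p take at most (p + 1)/2 values), and
-- since m is squarefree these choices glue by the Chinese remainder theorem.
-- Then the sequence m, cm, 1, m, cm, c, m, cm has no weighted zero-sum window
-- modulo m²: reducing modulo m, a window containing 1 or c (each occurs once)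
-- yields y² + c z² ≡ 0, and a window of multiples of m lies in a block m, cm
-- and yields m (y² + c z²) ≡ 0 (mod m²).  Either way some weight y is divisible
-- by m, so y² ≡ 0 (mod m²), which is not an admissible weight.  The prefixes of
-- this sequence rule out every length k ≤ 8.
module Submission where

open import Defs
open import Data.Bool using (Bool; true; false; T; _∧_)
open import Data.Bool.Properties using (T-∧)
open import Data.Fin using (Fin; toℕ; fromℕ<)
open import Data.Fin.Properties using (toℕ-fromℕ<; toℕ<n; any?; all?; ¬∀⟶∃¬; pigeonhole)
open import Data.List using (List; []; _∷_; _++_; length; map; zipWith; mapMaybe; take; drop)
open import Data.List.Properties using (∷-injective; ++-assoc; length-map; length-take; take++drop≡id)
open import Data.List.Relation.Unary.All as All using (All; []; _∷_)
open import Data.List.Relation.Unary.All.Properties using (All¬⇒¬Any)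
open import Data.List.Relation.Unary.Any using (Any; here)
open import Data.Maybe using (Maybe; just; nothing)
open import Data.Nat
  using (ℕ; zero; suc; _+_; _*_; _∸_; _≤_; _<_; z≤n; s≤s; _≤?_; NonZero; >-nonZero; nonTrivial⇒≢1; nonTrivial⇒n>1)
open import Data.Nat.Coprimality using (Coprime; coprime-Bézout; coprime⇒gcd≡1)
open import Data.Nat.Divisibility
open import Data.Nat.GCD using (module Bézout)
open import Data.Nat.LCM using (lcm; lcm-least; gcd*lcm)
open import Data.Nat.ListAction using (sum; product)
open import Data.Nat.DivMod using (_%_; _/_; m%n<n; m≡m%n+[m/n]*n)
open import Data.Nat.Primality using (Prime; prime⇒irreducible; prime⇒nonTrivial; euclidsLemma)
open import Data.Nat.Primality.Factorisation using (factorise; PrimeFactorisation)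
open import Data.Nat.Properties
open import Data.Nat.Tactic.RingSolver using (solve-∀)
open import Data.Product using (∃; _×_; _,_; proj₁; proj₂)
open import Data.Sum using (inj₁; inj₂; reduce)
open import Data.Empty using (⊥-elim)
open import Function using (_∘_; Equivalence)
open import Relation.Nullary using (¬_; yes; no; ¬?)
open import Relation.Nullary.Decidable using (decidable-stable)
open import Relation.Binary.PropositionalEquality

infix 4 _≡_mod_

record _≡_mod_ (x y n : ℕ) : Set where
  constructor mk≡mod
  field
    k l : ℕ
    x+nk≡y+nl : x + n * k ≡ y + n * l

∣-resp-≡mod : ∀ {n x y} → x ≡ y mod n → n ∣ x → n ∣ y
∣-resp-≡mod {n} {x} {y} (mk≡mod k l eq) n∣x =
  ∣m+n∣m⇒∣n (subst (n ∣_) (trans eq (+-comm y (n * l))) (∣m∣n⇒∣m+n n∣x (m∣m*n k))) (m∣m*n l)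

+-congˡ-≡mod : ∀ {n x y} a → x ≡ y mod n → a + x ≡ a + y mod n
+-congˡ-≡mod {n} {x} {y} a (mk≡mod k l eq) = mk≡mod k l (begin
  a + x + n * k   ≡⟨ +-assoc a x (n * k) ⟩
  a + (x + n * k) ≡⟨ cong (a +_) eq ⟩
  a + (y + n * l) ≡⟨ +-assoc a y (n * l) ⟨
  a + y + n * l   ∎)
  where open ≡-Reasoning

+-congʳ-≡mod : ∀ {n x y} b → x ≡ y mod n → x + b ≡ y + b mod n
+-congʳ-≡mod {n} {x} {y} b x≡y =
  subst₂ (_≡_mod n) (+-comm b x) (+-comm b y) (+-congˡ-≡mod b x≡y)

*-congˡ-≡mod : ∀ {n x y} a → x ≡ y mod n → a * x ≡ a * y mod n
*-congˡ-≡mod {n} {x} {y} a (mk≡mod k l eq) = mk≡mod (a * k) (a * l)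
  (trans (sym (distrib a x n k)) (trans (cong (a *_) eq) (distrib a y n l)))
  where
  distrib : ∀ a x n k → a * (x + n * k) ≡ a * x + n * (a * k)
  distrib = solve-∀

*-congʳ-≡mod : ∀ {n x y} b → x ≡ y mod n → x * b ≡ y * b mod n
*-congʳ-≡mod {n} {x} {y} b x≡y =
  subst₂ (_≡_mod n) (*-comm b x) (*-comm b y) (*-congˡ-≡mod b x≡y)

-- From 1 + y b = x a: y b is -1 modulo a and 0 modulo b, so (a - 1) y b and
-- 1 + y b are the idempotents for a and for b, and t = s (1 + y b) + r (a - 1) y b.
crt-Bézout : ∀ {a b} x y → 1 + y * b ≡ x * a →
             ∀ r s → ∃ λ t → t ≡ r mod a × t ≡ s mod b
crt-Bézout {zero} x y eq r s = ⊥-elim (1+n≢0 (trans eq (*-zeroʳ x)))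
crt-Bézout {suc a′} {b} x y eq r s =
  t , mk≡mod (r * x) (s * x + r * (y * b)) t≡r , mk≡mod 0 (s * y + r * (a′ * y)) t≡s
  where
  open ≡-Reasoning
  t = s * (1 + y * b) + r * (a′ * (y * b))
  t≡s : t + b * 0 ≡ s + b * (s * y + r * (a′ * y))
  t≡s = expand s y b r a′
    where
    expand : ∀ s y b r a′ → s * (1 + y * b) + r * (a′ * (y * b)) + b * 0 ≡ s + b * (s * y + r * (a′ * y))
    expand = solve-∀
  t≡r : t + (1 + a′) * (r * x) ≡ r + (1 + a′) * (s * x + r * (y * b))
  t≡r = begin
    s * (1 + E) + r * (a′ * E) + (1 + a′) * (r * x) ≡⟨ L₁ s E r a′ x ⟩
    s * (1 + E) + r * (a′ * E) + r * (x * (1 + a′)) ≡⟨ cong (λ u → s * (1 + E) + r * (a′ * E) + r * u) eq ⟨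
    s * (1 + E) + r * (a′ * E) + r * (1 + E)         ≡⟨ L₂ s E r a′ ⟩
    r + s * (1 + E) + (1 + a′) * (r * E)             ≡⟨ cong (λ u → r + s * u + (1 + a′) * (r * E)) eq ⟩
    r + s * (x * (1 + a′)) + (1 + a′) * (r * E)      ≡⟨ L₃ s E r a′ x ⟩
    r + (1 + a′) * (s * x + r * E)                   ∎
    where
    E = y * b
    L₁ : ∀ s E r a′ x → s * (1 + E) + r * (a′ * E) + (1 + a′) * (r * x) ≡ s * (1 + E) + r * (a′ * E) + r * (x * (1 + a′))
    L₁ = solve-∀
    L₂ : ∀ s E r a′ → s * (1 + E) + r * (a′ * E) + r * (1 + E) ≡ r + s * (1 + E) + (1 + a′) * (r * E)
    L₂ = solve-∀
    L₃ : ∀ s E r a′ x → r + s * (x * (1 + a′)) + (1 + a′) * (r * E) ≡ r + (1 + a′) * (s * x + r * E)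
    L₃ = solve-∀

crt : ∀ {a b} → Coprime a b → ∀ r s → ∃ λ t → t ≡ r mod a × t ≡ s mod b
crt {a} {b} cop r s with coprime-Bézout cop
... | Bézout.+- x y eq = crt-Bézout {a} {b} x y eq r s
... | Bézout.-+ x y eq with t , t≡s , t≡r ← crt-Bézout {b} {a} y x eq s r = t , t≡r , t≡s

Anisotropic : ℕ → ℕ → Set
Anisotropic n c = ∀ y z → n ∣ y * y + c * (z * z) → n ∣ y × n ∣ z

anisotropic-resp-≡mod : ∀ {n c d} → c ≡ d mod n → Anisotropic n d → Anisotropic n c
anisotropic-resp-≡mod c≡d an y z n∣ =
  an y z (∣-resp-≡mod (+-congˡ-≡mod (y * y) (*-congʳ-≡mod (z * z) c≡d)) n∣)

coprime⇒*-∣ : ∀ {a b t} → Coprime a b → a ∣ t → b ∣ t → a * b ∣ t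
coprime⇒*-∣ {a} {b} cop a∣t b∣t = subst (_∣ _) lcm≡* (lcm-least a∣t b∣t)
  where
  lcm≡* : lcm a b ≡ a * b
  lcm≡* = trans (sym (*-identityˡ (lcm a b)))
                (subst (λ g → g * lcm a b ≡ a * b) (coprime⇒gcd≡1 cop) (gcd*lcm a b))

anisotropic-* : ∀ {a b c} → Coprime a b → Anisotropic a c → Anisotropic b c → Anisotropic (a * b) c
anisotropic-* {a} {b} cop an-a an-b y z ab∣ =
  let a∣y , a∣z = an-a y z (m*n∣⇒m∣ a b ab∣)
      b∣y , b∣z = an-b y z (m*n∣⇒n∣ a b ab∣)
  in coprime⇒*-∣ cop a∣y b∣y , coprime⇒*-∣ cop a∣z b∣z

∃-anisotropic-* : ∀ {a b} → Coprime a b →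
                  ∃ (Anisotropic a) → ∃ (Anisotropic b) → ∃ (Anisotropic (a * b))
∃-anisotropic-* cop (c₁ , an₁) (c₂ , an₂) =
  let c , c≡c₁ , c≡c₂ = crt cop c₁ c₂
  in c , anisotropic-* {c = c} cop (anisotropic-resp-≡mod c≡c₁ an₁) (anisotropic-resp-≡mod c≡c₂ an₂)

Rootless : ℕ → ℕ → Set
Rootless n c = ∀ x → ¬ n ∣ x * x + c

odd⇒≡1+h+h : ∀ {n} → Odd n → ∃ λ h → n ≡ suc (h + h)
odd⇒≡1+h+h {zero}        odd = ⊥-elim (odd (2 ∣0))
odd⇒≡1+h+h {suc zero}    _   = 0 , refl
odd⇒≡1+h+h {suc (suc n)} odd =
  let h , n≡ = odd⇒≡1+h+h (odd ∘ ∣m∣n⇒∣m+n (∣-refl {2}))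
  in suc h , cong (suc ∘ suc) (trans n≡ (sym (+-suc h h)))

shift-∤ : ∀ {n u a b} → a < b → b < n → n ∣ u + a → ¬ n ∣ u + b
shift-∤ {n} {u} {a} {b} a<b b<n n∣u+a n∣u+b =
  <⇒≱ b<n (≤-trans (∣⇒≤ ⦃ >-nonZero (m<n⇒0<n∸m a<b) ⦄ n∣b∸a) (m∸n≤m b a))
  where
  u+a+[b∸a]≡u+b : u + a + (b ∸ a) ≡ u + b
  u+a+[b∸a]≡u+b = trans (+-assoc u a (b ∸ a)) (cong (u +_) (m+[n∸m]≡n (<⇒≤ a<b)))
  n∣b∸a : n ∣ b ∸ a
  n∣b∸a = ∣m+n∣m⇒∣n (subst (n ∣_) (sym u+a+[b∸a]≡u+b) n∣u+b) n∣u+a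

square-%-≡mod : ∀ x n .{{_ : NonZero n}} → x * x ≡ (x % n) * (x % n) mod n
square-%-≡mod x n = mk≡mod 0 (2 * (x % n) * (x / n) + (x / n) * (x / n) * n)
  (trans (cong (λ x → x * x + n * 0) (m≡m%n+[m/n]*n x n)) (expand (x % n) (x / n) n))
  where
  expand : ∀ r q n → (r + q * n) * (r + q * n) + n * 0 ≡ r * r + n * (2 * r * q + q * q * n)
  expand = solve-∀

square-∸-≡mod : ∀ {x n} → x ≤ n → x * x ≡ (n ∸ x) * (n ∸ x) mod n
square-∸-≡mod {x} {n} x≤n = mk≡mod n (2 * x)
  (subst (λ m → x * x + m * m ≡ (n ∸ x) * (n ∸ x) + m * (2 * x)) (m∸n+n≡m x≤n) (expand (n ∸ x) x))
  where
  expand : ∀ y x → x * x + (y + x) * (y + x) ≡ y * y + (y + x) * (2 * x)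
  expand = solve-∀

module _ (h : ℕ) where
  private
    n : ℕ
    n = suc (h + h)

  small-root : ∀ {x c} → n ∣ x * x + c → ∃ λ v → v ≤ h × n ∣ v * v + c
  small-root {x} {c} n∣ with x % n ≤? h
  ... | yes r≤h = x % n , r≤h , n∣r²+c
    where n∣r²+c = ∣-resp-≡mod (+-congʳ-≡mod c (square-%-≡mod x n)) n∣
  ... | no  r≰h = n ∸ x % n , n∸r≤h ,
                  ∣-resp-≡mod (+-congʳ-≡mod c (square-∸-≡mod (<⇒≤ (m%n<n x n)))) n∣r²+c
    where
    n∣r²+c = ∣-resp-≡mod (+-congʳ-≡mod c (square-%-≡mod x n)) n∣
    n∸r≤h : n ∸ x % n ≤ h
    n∸r≤h = ≤-trans (∸-monoʳ-≤ n (≰⇒> r≰h)) (≤-reflexive (m+n∸m≡n h h))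

  -- If every c < n had a root, it could be taken ≤ h, and by pigeonhole two
  -- values of c would share a root, hence be congruent modulo n.
  rootless-1+h+h : 0 < h → ∃ (Rootless n)
  rootless-1+h+h 0<h with any? (λ c → all? (λ i → ¬? (n ∣? toℕ i * toℕ i + toℕ c)))
  ... | yes (c , rootless) = toℕ c , λ x n∣ →
    let v , v≤h , n∣v²+c = small-root {x} n∣
        v<n = s≤s (≤-trans v≤h (m≤m+n h h))
    in rootless (fromℕ< v<n) (subst (λ v → n ∣ v * v + toℕ c) (sym (toℕ-fromℕ< v<n)) n∣v²+c)
  ... | no everyHasRoot = ⊥-elim (shift-∤ c₁<c₂ (toℕ<n c₂) (n∣root² c₁) n∣root₁²+c₂)
    where
    root : (c : Fin n) → ∃ λ v → v ≤ h × n ∣ v * v + toℕ c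
    root c with i , ¬¬n∣ ← ¬∀⟶∃¬ n _ (λ i → ¬? (n ∣? toℕ i * toℕ i + toℕ c))
                                   (λ rootless → everyHasRoot (c , rootless))
      = small-root {toℕ i} (decidable-stable (n ∣? _) ¬¬n∣)
    n∣root² : ∀ c → n ∣ proj₁ (root c) * proj₁ (root c) + toℕ c
    n∣root² c = proj₂ (proj₂ (root c))
    rootIndex : Fin n → Fin (suc h)
    rootIndex c = fromℕ< (s≤s (proj₁ (proj₂ (root c))))
    suc-h<n : suc h < n
    suc-h<n = s≤s (≤-trans (≤-reflexive (+-comm 1 h)) (+-monoʳ-≤ h 0<h))
    collision = pigeonhole suc-h<n rootIndex
    c₁ = proj₁ collision
    c₂ = proj₁ (proj₂ collision)
    c₁<c₂ = proj₁ (proj₂ (proj₂ collision))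
    same-root : proj₁ (root c₁) ≡ proj₁ (root c₂)
    same-root = trans (sym (toℕ-fromℕ< _))
                      (trans (cong toℕ (proj₂ (proj₂ (proj₂ collision)))) (toℕ-fromℕ< _))
    n∣root₁²+c₂ : n ∣ proj₁ (root c₁) * proj₁ (root c₁) + toℕ c₂
    n∣root₁²+c₂ = subst (λ v → n ∣ v * v + toℕ c₂) (sym same-root) (n∣root² c₂)

∃-rootless : ∀ {n} → Odd n → 1 < n → ∃ (Rootless n)
∃-rootless odd 1<n with h , refl ← odd⇒≡1+h+h odd = rootless-1+h+h h (0<h 1<n)
  where
  0<h : ∀ {h} → 1 < suc (h + h) → 0 < h
  0<h {zero}  (s≤s ())
  0<h {suc h} _ = s≤s z≤n

prime∤⇒coprime : ∀ {p n} → Prime p → ¬ p ∣ n → Coprime p n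
prime∤⇒coprime pr p∤n (d∣p , d∣n) with prime⇒irreducible pr d∣p
... | inj₁ d≡1  = d≡1
... | inj₂ refl = ⊥-elim (p∤n d∣n)

u≡1⇒u²≡1 : ∀ {n u} x → 1 + x * n ≡ u → u * u ≡ 1 mod n
u≡1⇒u²≡1 {n} x refl = mk≡mod 0 (2 * x + x * x * n) (expand x n)
  where
  expand : ∀ x n → (1 + x * n) * (1 + x * n) + n * 0 ≡ 1 + n * (2 * x + x * x * n)
  expand = solve-∀

u≡-1⇒u²≡1 : ∀ {n u} x → 1 + u ≡ x * n → u * u ≡ 1 mod n
u≡-1⇒u²≡1 {n} {u} x eq = mk≡mod (2 * x) (x * x * n) (begin
  u * u + n * (2 * x)   ≡⟨ L₁ u n x ⟩
  u * u + 2 * (x * n)   ≡⟨ cong (λ v → u * u + 2 * v) eq ⟨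
  u * u + 2 * (1 + u)   ≡⟨ L₂ u ⟩
  1 + (1 + u) * (1 + u) ≡⟨ cong (λ v → 1 + v * v) eq ⟩
  1 + x * n * (x * n)   ≡⟨ L₃ x n ⟩
  1 + n * (x * x * n)   ∎)
  where
  open ≡-Reasoning
  L₁ : ∀ u n x → u * u + n * (2 * x) ≡ u * u + 2 * (x * n)
  L₁ = solve-∀
  L₂ : ∀ u → u * u + 2 * (1 + u) ≡ 1 + (1 + u) * (1 + u)
  L₂ = solve-∀
  L₃ : ∀ x n → 1 + x * n * (x * n) ≡ 1 + n * (x * x * n)
  L₃ = solve-∀

∃-square-inverse : ∀ {p z} → Prime p → ¬ p ∣ z → ∃ λ w → w * z * (w * z) ≡ 1 mod p
∃-square-inverse pr p∤z with coprime-Bézout (prime∤⇒coprime pr p∤z)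
... | Bézout.+- x w eq = w , u≡-1⇒u²≡1 x eq
... | Bézout.-+ x w eq = w , u≡1⇒u²≡1 x eq

anisotropic-prime : ∀ {p c} → Prime p → Rootless p c → Anisotropic p c
anisotropic-prime {p} {c} pr rootless y z p∣ with p ∣? z
... | yes p∣z = reduce (euclidsLemma y y pr p∣y²) , p∣z
  where
  p∣y² : p ∣ y * y
  p∣y² = ∣m+n∣m⇒∣n (subst (p ∣_) (+-comm (y * y) _) p∣) (∣n⇒∣m*n c (∣m⇒∣m*n z p∣z))
... | no p∤z with w , [wz]²≡1 ← ∃-square-inverse pr p∤z = ⊥-elim (rootless (w * y) p∣[wy]²+c)
  where
  scale : ∀ w y c z → w * w * (y * y + c * (z * z)) ≡ w * y * (w * y) + c * (w * z * (w * z))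
  scale = solve-∀
  p∣[wy]²+c : p ∣ w * y * (w * y) + c
  p∣[wy]²+c = subst (λ t → p ∣ w * y * (w * y) + t) (*-identityʳ c)
    (∣-resp-≡mod (+-congˡ-≡mod (w * y * (w * y)) (*-congˡ-≡mod c [wz]²≡1))
                 (subst (p ∣_) (scale w y c z) (∣n⇒∣m*n (w * w) p∣)))

∃-anisotropic-prime : ∀ {p} → Prime p → Odd p → ∃ (Anisotropic p)
∃-anisotropic-prime {p} pr odd =
  let c , rootless = ∃-rootless odd (nonTrivial⇒n>1 p ⦃ prime⇒nonTrivial pr ⦄)
  in c , anisotropic-prime pr rootless

module _ {m} (odd : Odd m) (squarefree : Squarefree m) where

  ∃-anisotropic-∣ : ∀ {ps} → All Prime ps → product ps ∣ m → ∃ (Anisotropic (product ps))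
  ∃-anisotropic-∣ [] _ = 0 , λ y z _ → 1∣ y , 1∣ z
  ∃-anisotropic-∣ {p ∷ ps} (pr ∷ prs) p*ps∣m =
    ∃-anisotropic-* (prime∤⇒coprime pr p∤ps) (∃-anisotropic-prime pr p-odd)
                    (∃-anisotropic-∣ prs (∣-trans (n∣m*n p) p*ps∣m))
    where
    p∤ps : ¬ p ∣ product ps
    p∤ps p∣ps = nonTrivial⇒≢1 ⦃ prime⇒nonTrivial pr ⦄
                  (squarefree p (∣-trans (*-monoʳ-∣ p p∣ps) p*ps∣m))
    p-odd : Odd p
    p-odd 2∣p = odd (∣-trans 2∣p (∣-trans (m∣m*n (product ps)) p*ps∣m))

∃-anisotropic : ∀ {m} .{{_ : NonZero m}} → Odd m → Squarefree m → ∃ (Anisotropic m)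
∃-anisotropic {m} odd squarefree =
  subst (∃ ∘ Anisotropic) (sym isFactorisation)
        (∃-anisotropic-∣ odd squarefree factorsPrime (∣-reflexive (sym isFactorisation)))
  where open PrimeFactorisation (factorise m)

_or-else_ : {A : Set} → List A → List A → List A
[]       or-else ys = ys
(x ∷ xs) or-else _  = x ∷ xs

map-or-else : ∀ {A B : Set} (f : A → B) xs ys → map f (xs or-else ys) ≡ map f xs or-else map f ys
map-or-else f []       ys = refl
map-or-else f (x ∷ xs) ys = refl

All-or-else : ∀ {A : Set} {P : A → Set} {xs ys} → All P xs → All P ys → All P (xs or-else ys)
All-or-else {xs = []}    _   pys = pys
All-or-else {xs = _ ∷ _} pxs _   = pxs

allNonemptyPrefixes : {A : Set} → (List A → Bool) → List A → Bool
allNonemptyPrefixes p []       = true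
allNonemptyPrefixes p (x ∷ xs) = p (x ∷ []) ∧ allNonemptyPrefixes (p ∘ (x ∷_)) xs

allNonemptyInfixes : {A : Set} → (List A → Bool) → List A → Bool
allNonemptyInfixes p []       = true
allNonemptyInfixes p (x ∷ xs) = allNonemptyPrefixes p (x ∷ xs) ∧ allNonemptyInfixes p xs

module _ {A B : Set} (f : A → B) where

  allNonemptyPrefixes-sound : ∀ {p} ts {mid suf} → T (allNonemptyPrefixes p ts) →
                              map f ts ≡ mid ++ suf → mid ≢ [] → ∃ λ ts′ → mid ≡ map f ts′ × T (p ts′)
  allNonemptyPrefixes-sound ts       {[]}    _ _ mid≢[] = ⊥-elim (mid≢[] refl)
  allNonemptyPrefixes-sound []       {_ ∷ _} _ () _
  allNonemptyPrefixes-sound (t ∷ ts) {x ∷ []} all eq _ with refl ← proj₁ (∷-injective eq) =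
    t ∷ [] , refl , proj₁ (Equivalence.to T-∧ all)
  allNonemptyPrefixes-sound (t ∷ ts) {x ∷ mid@(_ ∷ _)} all eq _ with refl ← proj₁ (∷-injective eq) =
    let ts′ , mid≡ , pts′ = allNonemptyPrefixes-sound ts (proj₂ (Equivalence.to T-∧ all))
                                                      (proj₂ (∷-injective eq)) (λ ())
    in t ∷ ts′ , cong (f t ∷_) mid≡ , pts′

  allNonemptyInfixes-sound : ∀ {p} ts {pre mid suf} → T (allNonemptyInfixes p ts) →
                             map f ts ≡ pre ++ mid ++ suf → mid ≢ [] → ∃ λ ts′ → mid ≡ map f ts′ × T (p ts′)
  allNonemptyInfixes-sound []       {[]}    all eq = allNonemptyPrefixes-sound [] all eq
  allNonemptyInfixes-sound (t ∷ ts) {[]}    all eq = allNonemptyPrefixes-sound (t ∷ ts) (proj₁ (Equivalence.to T-∧ all)) eq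
  allNonemptyInfixes-sound []       {_ ∷ _} _   ()
  allNonemptyInfixes-sound (t ∷ ts) {_ ∷ pre} all eq =
    allNonemptyInfixes-sound ts {pre} (proj₂ (Equivalence.to T-∧ all)) (proj₂ (∷-injective eq))

HasConsecutiveWZS-++⁺ˡ : ∀ {n} xs ys → HasConsecutiveWZS n xs → HasConsecutiveWZS n (xs ++ ys)
HasConsecutiveWZS-++⁺ˡ xs ys (pre , mid , suf , split , rest) = pre , mid , suf ++ ys , split′ , rest
  where
  split′ : xs ++ ys ≡ pre ++ mid ++ suf ++ ys
  split′ = trans (cong (_++ ys) split)
                 (trans (++-assoc pre (mid ++ suf) ys) (cong (pre ++_) (++-assoc mid suf ys)))

weightedSum : List ℕ → List ℕ → ℕ
weightedSum ys xs = sum (zipWith _*_ (map (λ y → y * y) ys) xs)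

-- A term of the witness sequence is 1 or c (written nonres), possibly
-- multiplied by m.
data Coeff : Set where
  one nonres : Coeff

data Term : Set where
  unit scaled : Coeff → Term

unitPart scaledPart : Term → Maybe Coeff
unitPart (unit a)   = just a
unitPart (scaled _) = nothing
scaledPart (unit _)   = nothing
scaledPart (scaled a) = just a

select : (Term → Maybe Coeff) → List Term → List ℕ → List (Coeff × ℕ)
select sel []       _        = []
select sel (_ ∷ _)  []       = []
select sel (t ∷ ts) (y ∷ ys) with sel t
... | just a  = (a , y) ∷ select sel ts ys
... | nothing = select sel ts ys

select-coeffs : ∀ sel ts ys → length ys ≡ length ts → map proj₁ (select sel ts ys) ≡ mapMaybe sel ts
select-coeffs sel []       []       _   = refl
select-coeffs sel (t ∷ ts) (y ∷ ys) len with sel t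
... | just a  = cong (a ∷_) (select-coeffs sel ts ys (suc-injective len))
... | nothing = select-coeffs sel ts ys (suc-injective len)

select-weights : ∀ {P : ℕ → Set} sel ts {ys} → All P ys → All (P ∘ proj₂) (select sel ts ys)
select-weights sel []       _          = []
select-weights sel (_ ∷ _)  []         = []
select-weights sel (t ∷ ts) (py ∷ pys) with sel t
... | just a  = py ∷ select-weights sel ts pys
... | nothing = select-weights sel ts pys

core : List Term → List ℕ → List (Coeff × ℕ)
core ts ys = select unitPart ts ys or-else select scaledPart ts ys

coreCoeffs : List Term → List Coeff
coreCoeffs ts = mapMaybe unitPart ts or-else mapMaybe scaledPart ts

core-coeffs : ∀ ts ys → length ys ≡ length ts → map proj₁ (core ts ys) ≡ coreCoeffs ts
core-coeffs ts ys len = trans (map-or-else proj₁ (select unitPart ts ys) _)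
  (cong₂ _or-else_ (select-coeffs unitPart ts ys len) (select-coeffs scaledPart ts ys len))

witness : List Term
witness = scaled one ∷ scaled nonres ∷ unit one ∷ scaled one ∷ scaled nonres ∷
          unit nonres ∷ scaled one ∷ scaled nonres ∷ []

isSubform : List Coeff → Bool
isSubform (one ∷ [])          = true
isSubform (nonres ∷ [])       = true
isSubform (one ∷ nonres ∷ []) = true
isSubform _                   = false

-- Decided by evaluation over all 36 windows.
witness-windows-subform : T (allNonemptyInfixes (isSubform ∘ coreCoeffs) witness)
witness-windows-subform = _

module Window (m c : ℕ) where

  coeff : Coeff → ℕ
  coeff one    = 1
  coeff nonres = c

  value : Term → ℕ
  value (unit a)   = coeff a
  value (scaled a) = m * coeff a

  diagonal : List (Coeff × ℕ) → ℕ
  diagonal []             = 0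
  diagonal ((a , y) ∷ ps) = coeff a * (y * y) + diagonal ps

  weightedSum-split : ∀ ts ys → weightedSum ys (map value ts) ≡
                      diagonal (select unitPart ts ys) + m * diagonal (select scaledPart ts ys)
  weightedSum-split []      []      = sym (*-zeroʳ m)
  weightedSum-split []      (_ ∷ _) = sym (*-zeroʳ m)
  weightedSum-split (_ ∷ _) []      = sym (*-zeroʳ m)
  weightedSum-split (unit a ∷ ts) (y ∷ ys) =
    trans (cong (y * y * coeff a +_) (weightedSum-split ts ys)) (regroup (coeff a) (y * y) _ _ m)
    where
    regroup : ∀ a y² U S m → y² * a + (U + m * S) ≡ a * y² + U + m * S
    regroup = solve-∀
  weightedSum-split (scaled a ∷ ts) (y ∷ ys) =
    trans (cong (y * y * (m * coeff a) +_) (weightedSum-split ts ys)) (regroup (coeff a) (y * y) _ _ m)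
    where
    regroup : ∀ a y² U S m → y² * (m * a) + (U + m * S) ≡ U + m * (a * y² + S)
    regroup = solve-∀

  -- Modulo m the scaled terms vanish; a window without unit terms is divided by m.
  core-divisible : .{{NonZero m}} → ∀ ts ys → m * m ∣ weightedSum ys (map value ts) → m ∣ diagonal (core ts ys)
  core-divisible ts ys m²∣ with select unitPart ts ys | weightedSum-split ts ys
  ... | []     | split = *-cancelˡ-∣ m (subst (m * m ∣_) split m²∣)
  ... | u ∷ us | split = ∣m+n∣m⇒∣n (subst (m ∣_) (trans split (+-comm (diagonal (u ∷ us)) _)) (m*n∣⇒m∣ m m m²∣))
                                   (m∣m*n _)

  module _ (anisotropic : Anisotropic m c) where

    anisotropic-subform : ∀ ps → T (isSubform (map proj₁ ps)) → m ∣ diagonal ps → Any ((m ∣_) ∘ proj₂) ps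
    anisotropic-subform ((one , y) ∷ []) _ m∣ =
      here (proj₁ (anisotropic y 0 (subst (m ∣_) (only-y y c) m∣)))
      where
      only-y : ∀ y c → 1 * (y * y) + 0 ≡ y * y + c * (0 * 0)
      only-y = solve-∀
    anisotropic-subform ((nonres , z) ∷ []) _ m∣ =
      here (proj₂ (anisotropic 0 z (subst (m ∣_) (only-z z c) m∣)))
      where
      only-z : ∀ z c → c * (z * z) + 0 ≡ 0 * 0 + c * (z * z)
      only-z = solve-∀
    anisotropic-subform ((one , y) ∷ (nonres , z) ∷ []) _ m∣ =
      here (proj₁ (anisotropic y z (subst (m ∣_) (both y z c) m∣)))
      where
      both : ∀ y z c → 1 * (y * y) + (c * (z * z) + 0) ≡ y * y + c * (z * z)
      both = solve-∀
    anisotropic-subform [] ()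
    anisotropic-subform ((one , _) ∷ (one , _) ∷ _) ()
    anisotropic-subform ((one , _) ∷ (nonres , _) ∷ _ ∷ _) ()
    anisotropic-subform ((nonres , _) ∷ _ ∷ _) ()

    window-not-zero-sum : .{{NonZero m}} → ∀ ts → T (isSubform (coreCoeffs ts)) →
                          ∀ ys → length ys ≡ length ts → All (NonzeroSquareRoot (m * m)) ys →
                          ¬ m * m ∣ weightedSum ys (map value ts)
    window-not-zero-sum ts subform ys len admissible m²∣ =
      All¬⇒¬Any (All-or-else (select-weights unitPart ts m∤ys) (select-weights scaledPart ts m∤ys))
                (anisotropic-subform (core ts ys)
                  (subst (T ∘ isSubform) (sym (core-coeffs ts ys len)) subform)
                  (core-divisible ts ys m²∣))
      where
      m∤ys : All (λ y → ¬ m ∣ y) ys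
      m∤ys = All.map (λ m²∤y² m∣y → m²∤y² (*-pres-∣ m∣y m∣y)) admissible

  witness-zero-sum-free : Anisotropic m c → .{{NonZero m}} → ¬ HasConsecutiveWZS (m * m) (map value witness)
  witness-zero-sum-free anisotropic (pre , mid , suf , split , mid≢[] , ys , len , admissible , m²∣)
    with ts , refl , subform ← allNonemptyInfixes-sound value witness {pre} witness-windows-subform split mid≢[]
    = window-not-zero-sum anisotropic ts subform ys (trans len (length-map value ts)) admissible m²∣

theorem14 : ∀ (m : ℕ) → Odd m → Squarefree m →
              ∀ (k : ℕ) → 0 < k → CProperty (m * m) k → 9 ≤ k
theorem14 zero odd _ _ _ _ = ⊥-elim (odd (2 ∣0))
theorem14 m@(suc _) odd squarefree k _ property with 9 ≤? k
... | yes 9≤k = 9≤k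
... | no 9≰k with c , anisotropic ← ∃-anisotropic odd squarefree =
  ⊥-elim (witness-zero-sum-free anisotropic
    (subst (HasConsecutiveWZS (m * m)) (take++drop≡id k xs)
      (HasConsecutiveWZS-++⁺ˡ (take k xs) (drop k xs) (property (take k xs) |take-k|≡k))))
  where
  open Window m c
  xs = map value witness
  |take-k|≡k : length (take k xs) ≡ k
  |take-k|≡k = trans (length-take k xs) (m≤n⇒m⊓n≡m (≤-pred (≰⇒> 9≰k)))
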